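{- $ar(K_8,2P_4)=16$.
   Context: $2P_4$ is the disjoint union of two paths on $4$ vertices. A subgraph of an edge-colored graph is rainbow if all its edges receive distinct colors. For a graph $G$, $ar(K_n,G)$ is the maximum number of colors in an edge-coloring of $K_n$ containing no rainbow copy of $G$. -}

module Defs where

open import Data.Nat using (ℕ; _≤_)
open import Data.Fin using (Fin; zero; suc; #_)
open import Data.Product using (Σ; ∃; _×_; _,_; proj₁; proj₂)
open import Relation.Binary.PropositionalEquality using (_≡_; _≢_)
open import Relation.Nullary using (¬_)
open import Function.Definitions using (Injective)

record Graph : Set where
  field
    nV   : ℕ
    nE   : ℕ
    edge : Fin nE → Fin nV × Fin nV

open Graph public

2P4 : Graph
2P4 = record { nV = 8 ; nE = 6 ; edge = e }
  where
  e : Fin 6 → Fin 8 × Fin 8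
  e zero                               = (# 0 , # 1)
  e (suc zero)                         = (# 1 , # 2)
  e (suc (suc zero))                   = (# 2 , # 3)
  e (suc (suc (suc zero)))             = (# 4 , # 5)
  e (suc (suc (suc (suc zero))))       = (# 5 , # 6)
  e (suc (suc (suc (suc (suc zero))))) = (# 6 , # 7)

-- An edge-colouring of K_n using exactly k colours: a symmetric map on
-- pairs of vertices into Fin k (values on the diagonal are irrelevant),
-- such that every colour in Fin k appears on some edge {i,j}, i ≠ j.
record Colouring (n k : ℕ) : Set where
  field
    col  : Fin n → Fin n → Fin k
    sym  : ∀ i j → col i j ≡ col j i
    onto : ∀ (a : Fin k) → Σ (Fin n) λ i → Σ (Fin n) λ j → (i ≢ j) × (col i j ≡ a)

open Colouring public

RainbowCopy : ∀ {n k} → Colouring n k → Graph → Set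
RainbowCopy {n} c G =
  Σ (Fin (nV G) → Fin n) λ φ →
    Injective _≡_ _≡_ φ ×
    (∀ (e f : Fin (nE G)) → e ≢ f →
       col c (φ (proj₁ (edge G e))) (φ (proj₂ (edge G e)))
       ≢ col c (φ (proj₁ (edge G f))) (φ (proj₂ (edge G f))))

AntiRamseyIs : ℕ → Graph → ℕ → Set
AntiRamseyIs n G r =
  (Σ (Colouring n r) λ c → ¬ RainbowCopy c G) ×
  (∀ k (c : Colouring n k) → ¬ RainbowCopy c G → k ≤ r)

module Submission where

-- Lower bound: colour the K₆ on the vertices 0, …, 5 rainbow with 15 colours and every edge at
-- 6 or 7 with a 16th colour. A copy of 2P₄ spans all eight vertices, and as 2P₄ has no isolated
-- edge, 6 and 7 lie on two distinct edges of the copy, which share the 16th colour.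
-- Upper bound: if a perfect matching M is rainbow, the 24 edges outside M split into 12 pairs
-- {e, f} with M + e + f ≅ 2P₄; no such copy is rainbow, so each pair brings at most one colour
-- missing from M, giving at most 4 + 12 colours. If no perfect matching is rainbow, a search over
-- the colour patterns of K₈, which bounds the colours at each node by the same pairing argument
-- applied to the non-rainbow perfect matchings, again finds at most 16 colours.

open import Defs hiding (sym)
open import Data.Bool using (Bool; true; false; T; T?; _∨_; _∧_; if_then_else_)
open import Data.Bool.ListAction using (any; all)
open import Data.Bool.Properties using (T-∨; T-∧; T-≡)
open import Data.Empty using (⊥; ⊥-elim)
open import Data.Fin using (Fin; zero; suc; toℕ; #_; fromℕ<; punchOut; inject₁)
open import Data.Fin.Properties using (injective⇒≤; punchOut-injective; all?; any?; _<?_)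
  renaming (_≟_ to _≟ᶠ_)
open import Data.List as List using (List; []; _∷_; _++_; map; length; filter; filterᵇ; concatMap; allFin; head; drop)
open import Data.List.Properties using (length-++; length-map)
open import Data.List.Membership.Propositional using (_∈_; find; lose)
open import Data.List.Membership.Propositional.Properties using (∈-filter⁺; ∈-++⁻; ∈-concatMap⁻; ∈-allFin)
open import Data.List.Relation.Unary.All as All using (All; []; _∷_)
open import Data.List.Relation.Unary.All.Properties using (¬Any⇒All¬; all⁺) renaming (map⁺ to All-map⁺)
open import Data.List.Relation.Unary.Any as Any using (Any; here; there)
open import Data.List.Relation.Unary.Any.Properties using (++⁺ˡ; ++⁺ʳ; lookup-index) renaming (map⁺ to Any-map⁺)
open import Data.List.Relation.Unary.AllPairs using (AllPairs; []; _∷_; allPairs?)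
open import Data.List.Relation.Unary.AllPairs.Properties using () renaming (map⁻ to AllPairs-map⁻)
open import Data.Maybe using (Maybe; just; nothing; maybe′; is-nothing; fromMaybe)
open import Data.Nat using (ℕ; zero; suc; _+_; _⊔_; _⊓_; _≤_; _≤ᵇ_; _≤?_; s≤s)
  renaming (_≟_ to _≟ℕ_)
open import Data.Nat.Properties
  using (≤ᵇ⇒≤; ≤-trans; ≤-reflexive; ≤-refl; n≤1+n; 1+n≰n; m⊓n≤m; ⊔-comm; ⊓-comm)
open import Data.Product using (∃; ∃₂; _×_; _,_; proj₁; proj₂; uncurry)
open import Data.Product.Properties using () renaming (≡-dec to ×-≡-dec)
open import Data.Sum using (_⊎_; inj₁; inj₂)
open import Data.Sum.Properties using () renaming (≡-dec to ⊎-≡-dec)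
open import Data.Unit using (⊤; tt)
open import Function using (_∘_; Injective; Equivalence)
open import Relation.Binary.Definitions using (DecidableEquality; Symmetric)
open import Relation.Binary.PropositionalEquality using (_≡_; _≢_; refl; sym; trans; cong; cong₂; subst; ≢-sym)
open import Relation.Nullary using (¬_; Dec; yes; no; does; ¬?; _⊎-dec_; _×-dec_; _→-dec_; contradiction)
open import Relation.Nullary.Decidable using (from-yes; from-no; map′)

Rainbow : ∀ {E : Set} {k} → (E → Fin k) → List E → Set
Rainbow colour = AllPairs (λ x y → colour x ≢ colour y)

rainbow? : ∀ {E : Set} {k} (colour : E → Fin k) → ∀ C → Dec (Rainbow colour C)
rainbow? colour = allPairs? (λ x y → ¬? (colour x ≟ᶠ colour y))

Covers : ∀ {E : Set} {k} → (E → Fin k) → List E → E → Set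
Covers colour R x = Any (λ r → colour x ≡ colour r) R

allPairs-lookup : ∀ {A : Set} {R : A → A → Set} → Symmetric R →
                  ∀ {xs x y} → AllPairs R xs → x ∈ xs → y ∈ xs → x ≢ y → R x y
allPairs-lookup sym-R (r ∷ rs) (here refl) (here refl) x≢y = ⊥-elim (x≢y refl)
allPairs-lookup sym-R (r ∷ rs) (here refl) (there y∈) x≢y = All.lookup r y∈
allPairs-lookup sym-R (r ∷ rs) (there x∈) (here refl) x≢y = sym-R (All.lookup r x∈)
allPairs-lookup sym-R (r ∷ rs) (there x∈) (there y∈) x≢y = allPairs-lookup sym-R rs x∈ y∈ x≢y

allPairs-map∈ : ∀ {A : Set} {R S : A → A → Set} {xs} →
                (∀ {x y} → x ∈ xs → y ∈ xs → R x y → S x y) → AllPairs R xs → AllPairs S xs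
allPairs-map∈ f []       = []
allPairs-map∈ f (r ∷ rs) =
  All.tabulate (λ y∈ → f (here refl) (there y∈) (All.lookup r y∈)) ∷
  allPairs-map∈ (λ x∈ y∈ → f (there x∈) (there y∈)) rs

all-true : ∀ {A : Set} (p : A → Bool) xs → all p xs ≡ true → ∀ {x} → x ∈ xs → p x ≡ true
all-true p (y ∷ ys) eq (here refl) with p y
... | true = refl
all-true p (y ∷ ys) eq (there x∈) with p y
... | true = all-true p ys eq x∈

onto⇒≤length : ∀ {A : Set} {k} (f : A → Fin k) (R : List A) →
               (∀ a → Any (λ r → a ≡ f r) R) → k ≤ length R
onto⇒≤length f R hit = injective⇒≤ index-injective
  where
  index-injective : Injective _≡_ _≡_ (Any.index ∘ hit)
  index-injective {a} {b} eq =
    trans (lookup-index (hit a)) (trans (cong (f ∘ List.lookup R) eq) (sym (lookup-index (hit b))))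

injective⇒surjective : ∀ {n} {f : Fin n → Fin n} → Injective _≡_ _≡_ f → ∀ y → ∃ λ x → f x ≡ y
injective⇒surjective {suc n} {f} f-inj y with any? (λ x → f x ≟ᶠ y)
... | yes hit  = hit
... | no  miss = contradiction (injective⇒≤ g-inj) 1+n≰n
  where
  g : Fin (suc n) → Fin n
  g x = punchOut {i = y} {j = f x} (λ y≡fx → miss (x , sym y≡fx))
  g-inj : Injective _≡_ _≡_ g
  g-inj {a} {b} = f-inj ∘ punchOut-injective {i = y} {j = f a} {k = f b} _ _

injective? : ∀ {n} (f : Fin n → Fin n) → Dec (Injective _≡_ _≡_ f)
injective? f = map′ (λ h {x} {y} → h x y) (λ h x y → h {x} {y})
                   (all? λ x → all? λ y → (f x ≟ᶠ f y) →-dec (x ≟ᶠ y))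

-- The search runs through the edges, giving each either the colour of one of the representatives
-- chosen so far or a new colour, which makes it a representative. At a node, a forbidden (hence
-- non-rainbow) set C whose edges would get distinct colours if its unassigned edges got fresh ones
-- yields a verdict: with no unassigned edge the node is impossible; a single unassigned edge must
-- repeat a representative's colour; of two unassigned edges e, f one does, or e and f share a
-- colour, so {e, f} adds at most one colour. The node closes when the representatives, the edges
-- still unsettled and one edge per pair of a disjoint family of such pairs number at most the bound.
module PatternSearch {E : Set} (_≟_ : DecidableEquality E) (forbidden : List (List E)) (bound : ℕ) where

  open import Data.List.Membership.DecPropositional _≟_ using (_∈?_)

  Assignment : Set
  Assignment = List (E × E)

  representative : Assignment → E → Maybe E
  representative []              x = nothing
  representative ((e , r) ∷ asg) x = if does (x ≟ e) then just r else representative asg x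

  diagonal : List E → Assignment
  diagonal = map (λ e → e , e)

  data Known (asg : Assignment) (rest : List E) (x : E) : Set where
    assigned : ∀ {r} → representative asg x ≡ just r → Known asg rest x
    pending  : x ∈ rest → Known asg rest x

  unassigned : Assignment → List E → List E
  unassigned asg = filterᵇ (is-nothing ∘ representative asg)

  -- inj₁ r is the colour of the representative r, inj₂ x a fresh colour for the unassigned edge x.
  label : Assignment → E → E ⊎ E
  label asg x = maybe′ inj₁ (inj₂ x) (representative asg x)

  distinctLabels? : ∀ asg C → Dec (AllPairs _≢_ (map (label asg) C))
  distinctLabels? asg C = allPairs? (λ a b → ¬? (⊎-≡-dec _≟_ _≟_ a b)) (map (label asg) C)

  data Verdict : Set where
    rainbow : Verdict
    forced  : E → Verdict
    paired  : E → E → Verdict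
    silent  : Verdict

  classify : List E → Verdict
  classify []           = rainbow
  classify (e ∷ [])     = forced e
  classify (e ∷ f ∷ []) = paired e f
  classify _            = silent

  confirm : Assignment → List E → Verdict → Verdict
  confirm asg C silent = silent
  confirm asg C v      = if does (distinctLabels? asg C) then v else silent

  verdict : Assignment → List E → Verdict
  verdict asg C = confirm asg C (classify (unassigned asg C))

  verdicts : Assignment → List Verdict
  verdicts asg = map (verdict asg) forbidden

  isRainbow : Verdict → Bool
  isRainbow rainbow = true
  isRainbow _       = false

  forcedEdges : List Verdict → List E
  forcedEdges []              = []
  forcedEdges (forced e ∷ vs) = e ∷ forcedEdges vs
  forcedEdges (_ ∷ vs)        = forcedEdges vs

  disjointPairs : List E → List Verdict → List (E × E)
  disjointPairs used []                = []
  disjointPairs used (paired e f ∷ vs) =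
    if does (e ∈? used ⊎-dec f ∈? used)
    then disjointPairs used vs
    else (e , f) ∷ disjointPairs (e ∷ f ∷ used) vs
  disjointPairs used (_ ∷ vs)          = disjointPairs used vs

  bothEnds : E × E → List E
  bothEnds (e , f) = e ∷ f ∷ []

  ends : List (E × E) → List E
  ends = concatMap bothEnds

  unsettled : List E → List (E × E) → List E → List E
  unsettled fs ps = filter (λ x → ¬? (x ∈? (fs ++ ends ps)))

  -- The intermediate lists are passed as arguments so that they are computed once per node.
  fits : List E → List E → List E → List (E × E) → Bool
  fits reps rest fs ps = length reps + (length (unsettled fs ps rest) + length ps) ≤ᵇ bound

  settles : List E → List E → List Verdict → List E → Bool
  settles reps rest vs fs = any isRainbow vs ∨ fits reps rest fs (disjointPairs fs vs)

  closesWith : List E → List E → List Verdict → Bool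
  closesWith reps rest vs = settles reps rest vs (forcedEdges vs)

  closes : List E → Assignment → List E → Bool
  closes reps asg rest = closesWith reps rest (verdicts asg)

  search : List E → Assignment → List E → Bool
  search reps asg []         = closes reps asg []
  search reps asg (e ∷ rest) =
    closes reps asg (e ∷ rest) ∨
    (all (λ r → search reps ((e , r) ∷ asg) rest) reps ∧ search (e ∷ reps) ((e , e) ∷ asg) rest)

  searchFrom : List E → List E → Bool
  searchFrom reps edges = search reps (diagonal reps) (filter (λ x → ¬? (x ∈? reps)) edges)

  forcedEdges-∈ : ∀ vs {x} → x ∈ forcedEdges vs → forced x ∈ vs
  forcedEdges-∈ (rainbow      ∷ vs) x∈         = there (forcedEdges-∈ vs x∈)
  forcedEdges-∈ (forced e     ∷ vs) (here refl) = here refl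
  forcedEdges-∈ (forced e     ∷ vs) (there x∈)  = there (forcedEdges-∈ vs x∈)
  forcedEdges-∈ (paired e f   ∷ vs) x∈         = there (forcedEdges-∈ vs x∈)
  forcedEdges-∈ (silent       ∷ vs) x∈         = there (forcedEdges-∈ vs x∈)

  disjointPairs-∈ : ∀ used vs {e f} → (e , f) ∈ disjointPairs used vs → paired e f ∈ vs
  disjointPairs-∈ used (rainbow    ∷ vs) p∈ = there (disjointPairs-∈ used vs p∈)
  disjointPairs-∈ used (forced _   ∷ vs) p∈ = there (disjointPairs-∈ used vs p∈)
  disjointPairs-∈ used (silent     ∷ vs) p∈ = there (disjointPairs-∈ used vs p∈)
  disjointPairs-∈ used (paired e f ∷ vs) p∈ with does (e ∈? used ⊎-dec f ∈? used)
  ... | true = there (disjointPairs-∈ used vs p∈)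
  ... | false with p∈
  ...   | here refl = here refl
  ...   | there p∈′ = there (disjointPairs-∈ (e ∷ f ∷ used) vs p∈′)

  unassigned-∈ : ∀ asg {C x} → x ∈ C → representative asg x ≡ nothing → x ∈ unassigned asg C
  unassigned-∈ asg x∈ eq =
    ∈-filter⁺ (T? ∘ is-nothing ∘ representative asg) x∈ (subst (T ∘ is-nothing) (sym eq) tt)

  representative-here : ∀ {asg e r x} → x ≡ e → representative ((e , r) ∷ asg) x ≡ just r
  representative-here {e = e} refl with e ≟ e
  ... | yes _   = refl
  ... | no  e≢e = ⊥-elim (e≢e refl)

  representative-there : ∀ {asg e r x} → x ≢ e → representative ((e , r) ∷ asg) x ≡ representative asg x
  representative-there {e = e} {x = x} x≢e with x ≟ e
  ... | yes x≡e = ⊥-elim (x≢e x≡e)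
  ... | no  _   = refl

  known-step : ∀ {asg e r rest x} → Known asg (e ∷ rest) x → Known ((e , r) ∷ asg) rest x
  known-step {asg} {e} {r} {x = x} known with x ≟ e | known
  ... | yes x≡e | _                  = assigned (representative-here {asg} {e} {r} x≡e)
  ... | no  x≢e | assigned eq        = assigned (trans (representative-there {asg} {e} {r} x≢e) eq)
  ... | no  x≢e | pending (here x≡e) = ⊥-elim (x≢e x≡e)
  ... | no  _   | pending (there x∈) = pending x∈

  diagonal-assigned : ∀ {reps x} → x ∈ reps → representative (diagonal reps) x ≡ just x
  diagonal-assigned {e ∷ reps} {x} x∈ with x ≟ e | x∈
  ... | yes refl | _         = refl
  ... | no  x≢e  | here x≡e  = ⊥-elim (x≢e x≡e)
  ... | no  _    | there x∈′ = diagonal-assigned x∈′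

  module Soundness {k : ℕ} (colour : E → Fin k)
                   (forbidden-nonRainbow : All (λ C → ¬ Rainbow colour C) forbidden) where

    covers? : ∀ R x → Dec (Covers colour R x)
    covers? R x = Any.any? (λ r → colour x ≟ᶠ colour r) R

    record Consistent (reps : List E) (asg : Assignment) : Set where
      constructor consistent
      field
        represented : ∀ {x r} → representative asg x ≡ just r → r ∈ reps × colour x ≡ colour r

    open Consistent

    assign-old : ∀ {reps asg e r} → Consistent reps asg → r ∈ reps → colour e ≡ colour r →
                 Consistent reps ((e , r) ∷ asg)
    assign-old {reps} {asg} {e} {r} cons r∈ eq = consistent step
      where
      step : ∀ {x s} → representative ((e , r) ∷ asg) x ≡ just s → s ∈ reps × colour x ≡ colour s
      step {x} rep with x ≟ e
      step refl | yes refl = r∈ , eq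
      step rep  | no _     = represented cons rep

    assign-new : ∀ {reps asg e} → Consistent reps asg → Consistent (e ∷ reps) ((e , e) ∷ asg)
    assign-new {reps} {asg} {e} cons = consistent step
      where
      step : ∀ {x s} → representative ((e , e) ∷ asg) x ≡ just s → s ∈ e ∷ reps × colour x ≡ colour s
      step {x} rep with x ≟ e
      step refl | yes refl = here refl , refl
      step rep  | no _     = let s∈ , eq = represented cons rep in there s∈ , eq

    diagonal-consistent : ∀ reps → Consistent reps (diagonal reps)
    diagonal-consistent []         = consistent λ ()
    diagonal-consistent (e ∷ reps) = assign-new (diagonal-consistent reps)

    Fresh : List E → List E → Set
    Fresh reps us = All (λ x → ¬ Covers colour reps x) us × Rainbow colour us

    fresh⇒rainbow : ∀ {reps asg C} → Consistent reps asg → Rainbow colour reps →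
                    AllPairs _≢_ (map (label asg) C) → Fresh reps (unassigned asg C) → Rainbow colour C
    fresh⇒rainbow {reps} {asg} {C} cons rb distinct (fresh , rb-fresh) =
      allPairs-map∈ separate (AllPairs-map⁻ distinct)
      where
      separate : ∀ {x y} → x ∈ C → y ∈ C → label asg x ≢ label asg y → colour x ≢ colour y
      separate {x} {y} x∈ y∈ lx≢ly with representative asg x in ex | representative asg y in ey
      ... | just r  | just s  = λ eq →
        let r∈ , xr = represented cons ex ; s∈ , ys = represented cons ey
        in allPairs-lookup ≢-sym rb r∈ s∈ (lx≢ly ∘ cong inj₁) (trans (sym xr) (trans eq ys))
      ... | just r  | nothing = λ eq →
        let r∈ , xr = represented cons ex
        in All.lookup fresh (unassigned-∈ asg y∈ ey) (lose r∈ (trans (sym eq) xr))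
      ... | nothing | just s  = λ eq →
        let s∈ , ys = represented cons ey
        in All.lookup fresh (unassigned-∈ asg x∈ ex) (lose s∈ (trans eq ys))
      ... | nothing | nothing =
        allPairs-lookup ≢-sym rb-fresh (unassigned-∈ asg x∈ ex) (unassigned-∈ asg y∈ ey) (lx≢ly ∘ cong inj₂)

    Holds : List E → Verdict → Set
    Holds reps rainbow      = ⊥
    Holds reps (forced e)   = Covers colour reps e
    Holds reps (paired e f) = Covers colour reps e ⊎ Covers colour reps f ⊎ colour e ≡ colour f
    Holds reps silent       = ⊤

    verdict-holds : ∀ {reps asg} → Consistent reps asg → Rainbow colour reps →
                    ∀ {C} → ¬ Rainbow colour C → Holds reps (verdict asg C)
    verdict-holds {reps} {asg} cons rb {C} ¬rb = holds (unassigned asg C) refl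
      where
      impossible : ∀ {us} → unassigned asg C ≡ us → AllPairs _≢_ (map (label asg) C) → Fresh reps us → ⊥
      impossible eq distinct fresh = ¬rb (fresh⇒rainbow cons rb distinct (subst (Fresh reps) (sym eq) fresh))

      holds : ∀ us → unassigned asg C ≡ us → Holds reps (confirm asg C (classify us))
      holds [] eq with distinctLabels? asg C
      ... | yes d = impossible eq d ([] , [])
      ... | no  _ = tt
      holds (e ∷ []) eq with distinctLabels? asg C | covers? reps e
      ... | no  _ | _      = tt
      ... | yes _ | yes ce = ce
      ... | yes d | no ¬ce = ⊥-elim (impossible eq d ((¬ce ∷ []) , ([] ∷ [])))
      holds (e ∷ f ∷ []) eq with distinctLabels? asg C
      ... | no  _ = tt
      ... | yes d with covers? reps e | covers? reps f | colour e ≟ᶠ colour f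
      ...   | yes ce | _      | _      = inj₁ ce
      ...   | no  _  | yes cf | _      = inj₂ (inj₁ cf)
      ...   | no  _  | no  _  | yes ef = inj₂ (inj₂ ef)
      ...   | no ¬ce | no ¬cf | no ¬ef =
        ⊥-elim (impossible eq d ((¬ce ∷ ¬cf ∷ []) , ((¬ef ∷ []) ∷ [] ∷ [])))
      holds (_ ∷ _ ∷ _ ∷ _) eq = tt

    verdicts-hold : ∀ {reps asg} → Consistent reps asg → Rainbow colour reps → All (Holds reps) (verdicts asg)
    verdicts-hold cons rb = All-map⁺ (All.map (verdict-holds cons rb) forbidden-nonRainbow)

    rainbow-absent : ∀ {reps vs} → All (Holds reps) vs → ¬ T (any isRainbow vs)
    rainbow-absent {vs = rainbow    ∷ _} (h ∷ _)  _ = h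
    rainbow-absent {vs = forced _   ∷ _} (_ ∷ hs) t = rainbow-absent hs t
    rainbow-absent {vs = paired _ _ ∷ _} (_ ∷ hs) t = rainbow-absent hs t
    rainbow-absent {vs = silent     ∷ _} (_ ∷ hs) t = rainbow-absent hs t

    pick : List E → E × E → E
    pick reps (e , f) = if does (covers? reps e) then f else e

    pick-covers : ∀ {reps e f} → Holds reps (paired e f) →
                  ∀ {x} → x ∈ e ∷ f ∷ [] → Covers colour reps x ⊎ colour x ≡ colour (pick reps (e , f))
    pick-covers {reps} {e} h (here refl) with covers? reps e
    ... | yes ce = inj₁ ce
    ... | no  _  = inj₂ refl
    pick-covers {reps} {e} h (there (here refl)) with covers? reps e | h
    ... | yes _  | _               = inj₂ refl
    ... | no ¬ce | inj₁ ce         = ⊥-elim (¬ce ce)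
    ... | no  _  | inj₂ (inj₁ cf)  = inj₁ cf
    ... | no  _  | inj₂ (inj₂ ef)  = inj₂ (sym ef)

    ColourCover : Assignment → List E → Set
    ColourCover asg rest = ∃ λ R → length R ≤ bound × (∀ {x} → Known asg rest x → Covers colour R x)

    closes-sound : ∀ {reps asg} rest → Consistent reps asg → Rainbow colour reps →
                   T (closes reps asg rest) → ColourCover asg rest
    closes-sound {reps} {asg} rest cons rb t with Equivalence.to T-∨ t
    ... | inj₁ found = ⊥-elim (rainbow-absent (verdicts-hold cons rb) found)
    ... | inj₂ small = reps ++ unsettled fs ps rest ++ map (pick reps) ps , length-bound , covered
      where
      vs = verdicts asg
      fs = forcedEdges vs
      ps = disjointPairs fs vs

      holds : All (Holds reps) vs
      holds = verdicts-hold cons rb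

      length-bound : length (reps ++ unsettled fs ps rest ++ map (pick reps) ps) ≤ bound
      length-bound = ≤-trans (≤-reflexive count) (≤ᵇ⇒≤ _ bound small)
        where
        count : length (reps ++ unsettled fs ps rest ++ map (pick reps) ps) ≡
                length reps + (length (unsettled fs ps rest) + length ps)
        count = trans (length-++ reps)
                  (cong (length reps +_) (trans (length-++ (unsettled fs ps rest))
                    (cong (length (unsettled fs ps rest) +_) (length-map (pick reps) ps))))

      covered : ∀ {x} → Known asg rest x → Covers colour (reps ++ unsettled fs ps rest ++ map (pick reps) ps) x
      covered (assigned eq) = ++⁺ˡ (lose (proj₁ (represented cons eq)) (proj₂ (represented cons eq)))
      covered {x} (pending x∈) with x ∈? (fs ++ ends ps)
      ... | no x∉ = ++⁺ʳ reps (++⁺ˡ (lose (∈-filter⁺ (λ y → ¬? (y ∈? (fs ++ ends ps))) x∈ x∉) refl))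
      ... | yes x∈s with ∈-++⁻ fs x∈s
      ...   | inj₁ x∈fs = ++⁺ˡ (All.lookup holds (forcedEdges-∈ vs x∈fs))
      ...   | inj₂ x∈ends with find (∈-concatMap⁻ bothEnds {xs = ps} x∈ends)
      ...     | (e , f) , p∈ , x∈ef with pick-covers (All.lookup holds (disjointPairs-∈ fs vs p∈)) x∈ef
      ...       | inj₁ c  = ++⁺ˡ c
      ...       | inj₂ eq = ++⁺ʳ reps (++⁺ʳ (unsettled fs ps rest) (Any-map⁺ (lose p∈ eq)))

    colourCover-step : ∀ {asg e r rest} → ColourCover ((e , r) ∷ asg) rest → ColourCover asg (e ∷ rest)
    colourCover-step (R , R≤ , cover) = R , R≤ , cover ∘ known-step

    search-sound : ∀ {reps asg} rest → Consistent reps asg → Rainbow colour reps →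
                   T (search reps asg rest) → ColourCover asg rest
    search-sound [] cons rb t = closes-sound [] cons rb t
    search-sound {reps} (e ∷ rest) cons rb t with Equivalence.to T-∨ t
    ... | inj₁ c = closes-sound (e ∷ rest) cons rb c
    ... | inj₂ t′ with Equivalence.to T-∧ t′ | covers? reps e
    ...   | old , _ | yes ce =
      let r , r∈ , eq = find ce
      in colourCover-step (search-sound rest (assign-old cons r∈ eq) rb (All.lookup (all⁺ _ reps old) r∈))
    ...   | _ , new | no ¬ce =
      colourCover-step (search-sound rest (assign-new cons) (¬Any⇒All¬ reps ¬ce ∷ rb) new)

    searchFrom-sound : ∀ {reps} edges → Rainbow colour reps → searchFrom reps edges ≡ true →
                       ∃ λ R → length R ≤ bound × (∀ {x} → x ∈ edges → Covers colour R x)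
    searchFrom-sound {reps} edges rb t =
      let R , R≤ , cover = search-sound _ (diagonal-consistent reps) rb (Equivalence.from T-≡ t)
      in R , R≤ , cover ∘ known
      where
      known : ∀ {x} → x ∈ edges → Known (diagonal reps) (filter (λ y → ¬? (y ∈? reps)) edges) x
      known {x} x∈ with x ∈? reps
      ... | yes x∈reps = assigned (diagonal-assigned x∈reps)
      ... | no  x∉reps = pending (∈-filter⁺ (λ y → ¬? (y ∈? reps)) x∈ x∉reps)

triangle : ℕ → ℕ
triangle zero    = zero
triangle (suc n) = n + triangle n

edgeCode : ∀ {n} → Fin n → Fin n → ℕ
edgeCode i j = triangle (toℕ i ⊔ toℕ j) + toℕ i ⊓ toℕ j

edgeCode-comm : ∀ {n} (i j : Fin n) → edgeCode i j ≡ edgeCode j i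
edgeCode-comm i j = cong₂ _+_ (cong triangle (⊔-comm (toℕ i) (toℕ j))) (⊓-comm (toℕ i) (toℕ j))

colexPairs : List (Fin 8 × Fin 8)
colexPairs = concatMap (λ j → map (_, j) (filter (_<? j) (allFin 8))) (allFin 8)

endpoints : ℕ → Fin 8 × Fin 8
endpoints x = fromMaybe (zero , zero) (head (drop x colexPairs))

-- Facts decided by evaluation are opaque: unfolding the evidence of a decision procedure makes
-- type checking blow up.
opaque
  endpoints-edgeCode : ∀ (i j : Fin 8) → i ≢ j →
                       endpoints (edgeCode i j) ≡ (i , j) ⊎ endpoints (edgeCode i j) ≡ (j , i)
  endpoints-edgeCode = from-yes (all? λ (i : Fin 8) → all? λ j → ¬? (i ≟ᶠ j) →-dec
    (pair≟ (endpoints (edgeCode i j)) (i , j) ⊎-dec pair≟ (endpoints (edgeCode i j)) (j , i)))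
    where
    pair≟ : DecidableEquality (Fin 8 × Fin 8)
    pair≟ = ×-≡-dec _≟ᶠ_ _≟ᶠ_

edgeColour : ∀ {k} → Colouring 8 k → ℕ → Fin k
edgeColour c = uncurry (col c) ∘ endpoints

edgeColour-edgeCode : ∀ {k} (c : Colouring 8 k) {i j} → i ≢ j → edgeColour c (edgeCode i j) ≡ col c i j
edgeColour-edgeCode c {i} {j} i≢j with endpoints-edgeCode i j i≢j
... | inj₁ eq = cong (uncurry (col c)) eq
... | inj₂ eq = trans (cong (uncurry (col c)) eq) (Colouring.sym c j i)

-- The 1-factorisation {i, i xor d}, d = 1, 2, 4, 7, 3, 5, 6; in this order the search stays small.
allEdges : List ℕ
allEdges = map (uncurry (edgeCode {8}))
  ( (# 0 , # 1) ∷ (# 2 , # 3) ∷ (# 4 , # 5) ∷ (# 6 , # 7)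
  ∷ (# 0 , # 2) ∷ (# 1 , # 3) ∷ (# 4 , # 6) ∷ (# 5 , # 7)
  ∷ (# 0 , # 4) ∷ (# 1 , # 5) ∷ (# 2 , # 6) ∷ (# 3 , # 7)
  ∷ (# 0 , # 7) ∷ (# 1 , # 6) ∷ (# 2 , # 5) ∷ (# 3 , # 4)
  ∷ (# 0 , # 3) ∷ (# 1 , # 2) ∷ (# 4 , # 7) ∷ (# 5 , # 6)
  ∷ (# 0 , # 5) ∷ (# 1 , # 4) ∷ (# 2 , # 7) ∷ (# 3 , # 6)
  ∷ (# 0 , # 6) ∷ (# 1 , # 7) ∷ (# 2 , # 4) ∷ (# 3 , # 5) ∷ [])

opaque
  edgeCode-∈-allEdges : ∀ (i j : Fin 8) → i ≢ j → edgeCode i j ∈ allEdges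
  edgeCode-∈-allEdges =
    from-yes (all? λ (i : Fin 8) → all? λ j → ¬? (i ≟ᶠ j) →-dec edgeCode i j ∈? allEdges)
    where open import Data.List.Membership.DecPropositional _≟ℕ_ using (_∈?_)

cover⇒colours≤ : ∀ {k b} (c : Colouring 8 k) →
                (∃ λ R → length R ≤ b × (∀ {x} → x ∈ allEdges → Covers (edgeColour c) R x)) → k ≤ b
cover⇒colours≤ c (R , R≤b , cover) = ≤-trans (onto⇒≤length (edgeColour c) R hit) R≤b
  where
  hit : ∀ a → Any (λ r → a ≡ edgeColour c r) R
  hit a with onto c a
  ... | i , j , i≢j , eq =
    Any.map (trans (sym (trans (edgeColour-edgeCode c i≢j) eq))) (cover (edgeCode-∈-allEdges i j i≢j))

Loopless : Graph → Set
Loopless G = ∀ e → proj₁ (edge G e) ≢ proj₂ (edge G e)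

opaque
  2P4-loopless : Loopless 2P4
  2P4-loopless = from-yes (all? λ e → ¬? (proj₁ (edge 2P4 e) ≟ᶠ proj₂ (edge 2P4 e)))

imageCodes : (G : Graph) → (Fin (nV G) → Fin 8) → List ℕ
imageCodes G φ = map (λ e → edgeCode (φ (proj₁ (edge G e))) (φ (proj₂ (edge G e)))) (allFin (nE G))

rainbow-image⇒RainbowCopy : ∀ {k} (c : Colouring 8 k) {G} → Loopless G → ∀ {φ} → Injective _≡_ _≡_ φ →
                            Rainbow (edgeColour c) (imageCodes G φ) → RainbowCopy c G
rainbow-image⇒RainbowCopy c {G} loopless {φ} φ-inj rainbow = φ , φ-inj , distinct
  where
  colour-image : ∀ e → edgeColour c (edgeCode (φ (proj₁ (edge G e))) (φ (proj₂ (edge G e))))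
                     ≡ col c (φ (proj₁ (edge G e))) (φ (proj₂ (edge G e)))
  colour-image e = edgeColour-edgeCode c (loopless e ∘ φ-inj)

  distinct : ∀ e f → e ≢ f → col c (φ (proj₁ (edge G e))) (φ (proj₂ (edge G e)))
                           ≢ col c (φ (proj₁ (edge G f))) (φ (proj₂ (edge G f)))
  distinct e f e≢f eq = allPairs-lookup ≢-sym (AllPairs-map⁻ rainbow) (∈-allFin e) (∈-allFin f) e≢f
                          (trans (colour-image e) (trans eq (sym (colour-image f))))

-- Pairs inside {0, …, 5} have the colex ranks 0, …, 14; pairs meeting 6 or 7 have larger ranks.
capped : ℕ → Fin 16
capped x = fromℕ< (s≤s (m⊓n≤m 15 x))

lowerColour : Fin 8 → Fin 8 → Fin 16
lowerColour i j = capped (edgeCode i j)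

lowerColour-sym : ∀ i j → lowerColour i j ≡ lowerColour j i
lowerColour-sym i j = cong capped (edgeCode-comm i j)

opaque
  lowerColour-onto : ∀ a → ∃₂ λ i j → i ≢ j × lowerColour i j ≡ a
  lowerColour-onto = from-yes (all? λ a → any? λ i → any? λ j → ¬? (i ≟ᶠ j) ×-dec lowerColour i j ≟ᶠ a)

lowerColouring : Colouring 8 16
lowerColouring = record
  { col  = lowerColour
  ; sym  = lowerColour-sym
  ; onto = lowerColour-onto
  }

opaque
  6≤⇒lowerColour≡15 : ∀ v w → 6 ≤ toℕ v → lowerColour v w ≡ # 15
  6≤⇒lowerColour≡15 = from-yes (all? λ v → all? λ w → (6 ≤? toℕ v) →-dec lowerColour v w ≟ᶠ # 15)

Incident : (G : Graph) → Fin (nV G) → Fin (nE G) → Set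
Incident G p e = p ≡ proj₁ (edge G e) ⊎ p ≡ proj₂ (edge G e)

opaque
  2P4-distinct-incident-edges : ∀ p q → p ≢ q → ∃₂ λ e f → e ≢ f × Incident 2P4 p e × Incident 2P4 q f
  2P4-distinct-incident-edges = from-yes (all? λ p → all? λ q → ¬? (p ≟ᶠ q) →-dec
    any? λ e → any? λ f → ¬? (e ≟ᶠ f) ×-dec incident? p e ×-dec incident? q f)
    where
    incident? : ∀ p e → Dec (Incident 2P4 p e)
    incident? p e = (p ≟ᶠ proj₁ (edge 2P4 e)) ⊎-dec (p ≟ᶠ proj₂ (edge 2P4 e))

incident⇒lowerColour≡15 : ∀ {G} (φ : Fin (nV G) → Fin 8) e {p} → Incident G p e → 6 ≤ toℕ (φ p) →
                          lowerColour (φ (proj₁ (edge G e))) (φ (proj₂ (edge G e))) ≡ # 15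
incident⇒lowerColour≡15 {G} φ e (inj₁ refl) outer =
  6≤⇒lowerColour≡15 (φ (proj₁ (edge G e))) (φ (proj₂ (edge G e))) outer
incident⇒lowerColour≡15 {G} φ e (inj₂ refl) outer =
  trans (lowerColour-sym (φ (proj₁ (edge G e))) (φ (proj₂ (edge G e))))
        (6≤⇒lowerColour≡15 (φ (proj₂ (edge G e))) (φ (proj₁ (edge G e))) outer)

lowerColouring-noRainbow : ¬ RainbowCopy lowerColouring 2P4
lowerColouring-noRainbow (φ , φ-inj , rainbow)
  with injective⇒surjective φ-inj (# 6) | injective⇒surjective φ-inj (# 7)
... | p , φp≡6 | q , φq≡7
  with 2P4-distinct-incident-edges p q
         (λ p≡q → from-no (_≟ᶠ_ {8} (# 6) (# 7)) (trans (sym φp≡6) (trans (cong φ p≡q) φq≡7)))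
... | e , f , e≢f , p∈e , q∈f =
  rainbow e f e≢f
    (trans (incident⇒lowerColour≡15 {2P4} φ e p∈e (subst ((6 ≤_) ∘ toℕ) (sym φp≡6) ≤-refl))
      (sym (incident⇒lowerColour≡15 {2P4} φ f q∈f (subst ((6 ≤_) ∘ toℕ) (sym φq≡7) (n≤1+n 6)))))

matchingOrders : ℕ → List (Fin 8) → List (List (Fin 8))
matchingOrders zero    _        = [] ∷ []
matchingOrders (suc m) []       = []
matchingOrders (suc m) (x ∷ xs) =
  concatMap (λ y → map (λ o → x ∷ y ∷ o) (matchingOrders m (filter (λ z → ¬? (z ≟ᶠ y)) xs))) xs

-- Each perfect matching v₀v₁, v₂v₃, v₄v₅, v₆v₇ of K₈, as the vertex order v₀ … v₇.
perfectMatchings : List (List (Fin 8))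
perfectMatchings = matchingOrders 4 (allFin 8)

matchingEdges : List (Fin 8) → List ℕ
matchingEdges (a ∷ b ∷ vs) = edgeCode a b ∷ matchingEdges vs
matchingEdges _            = []

-- The fallback for short lists is never used: all orders below have eight entries.
at : List (Fin 8) → Fin 8 → Fin 8
at []       i       = i
at (v ∷ vs) zero    = v
at (v ∷ vs) (suc i) = at vs (inject₁ i)

-- The copies a′abb′ ∪ c′cdd′ of 2P₄ whose end edges form the matching 01, 23, 45, 67, given as
-- orders of positions; their middle edges {ab, cd} are the 12 pairs of the upper-bound argument,
-- so when the matching is rainbow the search closes at its root.
pathOrders : List (List (Fin 8))
pathOrders =
    (# 1 ∷ # 0 ∷ # 2 ∷ # 3 ∷ # 5 ∷ # 4 ∷ # 6 ∷ # 7 ∷ [])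
  ∷ (# 1 ∷ # 0 ∷ # 3 ∷ # 2 ∷ # 5 ∷ # 4 ∷ # 7 ∷ # 6 ∷ [])
  ∷ (# 0 ∷ # 1 ∷ # 2 ∷ # 3 ∷ # 4 ∷ # 5 ∷ # 6 ∷ # 7 ∷ [])
  ∷ (# 0 ∷ # 1 ∷ # 3 ∷ # 2 ∷ # 4 ∷ # 5 ∷ # 7 ∷ # 6 ∷ [])
  ∷ (# 1 ∷ # 0 ∷ # 4 ∷ # 5 ∷ # 3 ∷ # 2 ∷ # 6 ∷ # 7 ∷ [])
  ∷ (# 1 ∷ # 0 ∷ # 5 ∷ # 4 ∷ # 3 ∷ # 2 ∷ # 7 ∷ # 6 ∷ [])
  ∷ (# 0 ∷ # 1 ∷ # 4 ∷ # 5 ∷ # 2 ∷ # 3 ∷ # 6 ∷ # 7 ∷ [])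
  ∷ (# 0 ∷ # 1 ∷ # 5 ∷ # 4 ∷ # 2 ∷ # 3 ∷ # 7 ∷ # 6 ∷ [])
  ∷ (# 1 ∷ # 0 ∷ # 6 ∷ # 7 ∷ # 3 ∷ # 2 ∷ # 4 ∷ # 5 ∷ [])
  ∷ (# 1 ∷ # 0 ∷ # 7 ∷ # 6 ∷ # 3 ∷ # 2 ∷ # 5 ∷ # 4 ∷ [])
  ∷ (# 0 ∷ # 1 ∷ # 6 ∷ # 7 ∷ # 2 ∷ # 3 ∷ # 4 ∷ # 5 ∷ [])
  ∷ (# 0 ∷ # 1 ∷ # 7 ∷ # 6 ∷ # 2 ∷ # 3 ∷ # 5 ∷ # 4 ∷ [])
  ∷ []

copiesExtending : List (Fin 8) → List (List ℕ)
copiesExtending π = map (λ σ → imageCodes 2P4 (at π ∘ at σ)) pathOrders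

opaque
  perfectMatchings-injective : All (Injective _≡_ _≡_ ∘ at) perfectMatchings
  perfectMatchings-injective = from-yes (All.all? (injective? ∘ at) perfectMatchings)

opaque
  pathOrders-injective : All (Injective _≡_ _≡_ ∘ at) pathOrders
  pathOrders-injective = from-yes (All.all? (injective? ∘ at) pathOrders)

noRainbowMatching-certificate :
  PatternSearch.searchFrom _≟ℕ_ (map matchingEdges perfectMatchings) 16 [] allEdges ≡ true
noRainbowMatching-certificate = refl

rainbowMatching-certificate : ∀ {π} → π ∈ perfectMatchings →
  PatternSearch.searchFrom _≟ℕ_ (copiesExtending π) 16 (matchingEdges π) allEdges ≡ true
rainbowMatching-certificate =
  all-true (λ π → PatternSearch.searchFrom _≟ℕ_ (copiesExtending π) 16 (matchingEdges π) allEdges)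
           perfectMatchings refl

noRainbowMatching⇒≤16 : ∀ {k} (c : Colouring 8 k) →
                        ¬ Any (Rainbow (edgeColour c) ∘ matchingEdges) perfectMatchings → k ≤ 16
noRainbowMatching⇒≤16 c none = cover⇒colours≤ c
  (PatternSearch.Soundness.searchFrom-sound _≟ℕ_ (map matchingEdges perfectMatchings) 16 (edgeColour c) nonRainbow
    allEdges [] noRainbowMatching-certificate)
  where
  nonRainbow : All (λ C → ¬ Rainbow (edgeColour c) C) (map matchingEdges perfectMatchings)
  nonRainbow = All-map⁺ (¬Any⇒All¬ perfectMatchings none)

rainbowMatching⇒≤16 : ∀ {k} (c : Colouring 8 k) → ¬ RainbowCopy c 2P4 →
                      ∀ {π} → π ∈ perfectMatchings → Rainbow (edgeColour c) (matchingEdges π) → k ≤ 16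
rainbowMatching⇒≤16 c noCopy {π} π∈ rainbow = cover⇒colours≤ c
  (PatternSearch.Soundness.searchFrom-sound _≟ℕ_ (copiesExtending π) 16 (edgeColour c) nonRainbow
    allEdges rainbow (rainbowMatching-certificate π∈))
  where
  nonRainbow : All (λ C → ¬ Rainbow (edgeColour c) C) (copiesExtending π)
  nonRainbow = All-map⁺ (All.tabulate λ σ∈ → noCopy ∘ rainbow-image⇒RainbowCopy c 2P4-loopless
                 (All.lookup pathOrders-injective σ∈ ∘ All.lookup perfectMatchings-injective π∈))

upperBound : ∀ {k} (c : Colouring 8 k) → ¬ RainbowCopy c 2P4 → k ≤ 16
upperBound {k} c noCopy = byCases (Any.any? (rainbow? (edgeColour c) ∘ matchingEdges) perfectMatchings)
  where
  byCases : Dec (Any (Rainbow (edgeColour c) ∘ matchingEdges) perfectMatchings) → k ≤ 16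
  byCases (no  none)  = noRainbowMatching⇒≤16 c none
  byCases (yes found) = let π , π∈ , rainbow = find found in rainbowMatching⇒≤16 c noCopy π∈ rainbow

lemma1 : AntiRamseyIs 8 2P4 16
lemma1 = (lowerColouring , lowerColouring-noRainbow) , λ k c noCopy → upperBound c noCopy
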